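{- For every $n\ge1$ and $\pi\in\mathfrak{S}_n$, \[\mathcal{D}^{(\ell)}(\pi)(X_0Y_0)=\sum_{\substack{\sigma,\tau\in\mathfrak{S}_n\\ \sigma\tau=\pi}}\mathcal{D}^{(\ell)}(\sigma)(X_0)\,\mathcal{D}^{(\ell)}(\tau)(Y_0).\]
   Context: $\mathfrak{S}_n$ is the symmetric group on $[n]$, product $(\sigma\tau)(i)=\sigma(\tau(i))$; $\mathrm{Des}(\pi)=\{i\in[n-1]:\pi(i)>\pi(i+1)\}$. $X_0=\{x_0,x_1,\dots\}$, $Y_0=\{y_0,y_1,\dots\}$ are commuting indeterminates. $\mathbb{P}^{(\ell)}=\{0,-1,1,-2,2,\dots\}$ with total order $0<-1<1<-2<2<\cdots$; integers $\ge0$ are nonnegative, the others negative. In a totally ordered set whose elements are nonnegative or negative, $a\le^+b$ means $a<b$ or ($a=b$ and $a$ nonnegative), and $a\le^-b$ means $a<b$ or ($a=b$ and $a$ negative). For $\sigma\in\mathfrak{S}_n$, $\mathcal{D}^{(\ell)}(\sigma)(X_0)=\sum\prod_{s=1}^n x_{|a_s|}$ over all $(a_1,\dots,a_n)\in(\mathbb{P}^{(\ell)})^n$ with $a_s\le^+a_{s+1}$ for $s\in[n-1]\setminus\mathrm{Des}(\sigma)$ and $a_s\le^-a_{s+1}$ for $s\in\mathrm{Des}(\sigma)$; $\mathcal{D}^{(\ell)}(\tau)(Y_0)$ is the same with $y$ in place of $x$. Equip $\mathbb{P}^{(\ell)}\times\mathbb{P}^{(\ell)}$ with the up-down total order: $(i,j)<(i',j')$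 iff $i<i'$, or $i=i'\ge0$ and $j<j'$, or $i=i'<0$ and $j>j'$ (comparisons in $\mathbb{P}^{(\ell)}$); a pair $(i,j)$ is nonnegative if ($i\ge0$ and $j\ge0$) or ($i<0$ and $j<0$), and negative otherwise. Then $\mathcal{D}^{(\ell)}(\pi)(X_0Y_0)=\sum\prod_{s=1}^n y_{|i_s|}x_{|j_s|}$ over all sequences $((i_1,j_1),\dots,(i_n,j_n))$ of pairs with $(i_s,j_s)\le^+(i_{s+1},j_{s+1})$ for $s\notin\mathrm{Des}(\pi)$ and $(i_s,j_s)\le^-(i_{s+1},j_{s+1})$ for $s\in\mathrm{Des}(\pi)$. -}

module Defs where

open import Data.Bool using (Bool; true; false; _∧_; _∨_; not; if_then_else_)
open import Data.Nat using (ℕ; zero; suc; _+_; _*_; _<ᵇ_; _≡ᵇ_; _/_; _%_)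
open import Data.Integer using (ℤ; +_; -[1+_]; ∣_∣)
import Data.Integer as ℤ
open import Data.Fin using (Fin; toℕ)
import Data.Fin as Fin
open import Data.List using (List; []; _∷_; map; concatMap; length; upTo; allFin; _++_)
open import Data.Nat.ListAction using (sum)
open import Data.Bool.ListAction using (any; all)
open import Data.Vec using (Vec; lookup; toList)
import Data.Vec as Vec
import Data.Vec.Properties as VecP
open import Data.Product using (_×_; _,_)
open import Relation.Nullary.Decidable using (⌊_⌋)

-- The set P^(ℓ) = {0,-1,1,-2,2,...}, realised as ℤ.
-- Total order 0 < -1 < 1 < -2 < 2 < ... is given by the position rank.

rank : ℤ → ℕ
rank (+ n)     = n * 2
rank -[1+ n ]  = suc (n * 2)

ltP : ℤ → ℤ → Bool
ltP a b = rank a <ᵇ rank b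

eqP : ℤ → ℤ → Bool
eqP a b = ⌊ a ℤ.≟ b ⌋

negP : ℤ → Bool
negP (+ _)     = false
negP -[1+ _ ]  = true

le⁺ : {A : Set} → (A → A → Bool) → (A → A → Bool) → (A → Bool) → A → A → Bool
le⁺ lt eq neg a b = lt a b ∨ (eq a b ∧ not (neg a))

le⁻ : {A : Set} → (A → A → Bool) → (A → A → Bool) → (A → Bool) → A → A → Bool
le⁻ lt eq neg a b = lt a b ∨ (eq a b ∧ neg a)

ltPair : ℤ × ℤ → ℤ × ℤ → Bool
ltPair (i , j) (i' , j') =
  ltP i i' ∨ (eqP i i' ∧ ((not (negP i) ∧ ltP j j') ∨ (negP i ∧ ltP j' j)))

eqPair : ℤ × ℤ → ℤ × ℤ → Bool
eqPair (i , j) (i' , j') = eqP i i' ∧ eqP j j'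

negPair : ℤ × ℤ → Bool
negPair (i , j) = (negP i ∧ not (negP j)) ∨ (not (negP i) ∧ negP j)

-- Descent-compatibility of a sequence (a_1,...,a_n) with a permutation
-- given in one-line notation (π(1),...,π(n)):
-- a_s ≤⁻ a_{s+1} if s ∈ Des(π), a_s ≤⁺ a_{s+1} otherwise.

compat : {A : Set} → (A → A → Bool) → (A → A → Bool) →
         List ℕ → List A → Bool
compat l⁺ l⁻ (p ∷ q ∷ ps) (a ∷ b ∷ as) =
  (if q <ᵇ p then l⁻ a b else l⁺ a b) ∧ compat l⁺ l⁻ (q ∷ ps) (b ∷ as)
compat l⁺ l⁻ _ _ = true

-- Permutations of [n] in one-line notation (0-based): Vec (Fin n) n.
oneLine : {n : ℕ} → Vec (Fin n) n → List ℕ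
oneLine π = map toℕ (toList π)

countB : {A : Set} → (A → Bool) → List A → ℕ
countB p []       = 0
countB p (x ∷ xs) = if p x then suc (countB p xs) else countB p xs

seqs : {A : Set} → ℕ → List A → List (List A)
seqs zero    c = [] ∷ []
seqs (suc k) c = concatMap (λ x → map (x ∷_) (seqs k c)) c

vecs : {A : Set} → (k : ℕ) → List A → List (Vec A k)
vecs zero    c = Vec.[] ∷ []
vecs (suc k) c = concatMap (λ x → map (x Vec.∷_) (vecs k c)) c

decode : ℕ → ℤ
decode c = if c % 2 ≡ᵇ 0 then + (c / 2) else -[1+ c / 2 ]

cands : ℕ → List ℤ
cands B = map decode (upTo (suc (B * 2)))

candPairs : ℕ → List (ℤ × ℤ)
candPairs B = concatMap (λ i → map (i ,_) (cands B)) (cands B)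

countN : ℕ → List ℕ → ℕ
countN k = countB (λ m → m ≡ᵇ k)

msEq : List ℕ → List ℕ → Bool
msEq u v = (length u ≡ᵇ length v) ∧ all (λ k → countN k u ≡ᵇ countN k v) (u ++ v)

-- Monomials: a monomial x_{w_1} x_{w_2} ... x_{w_k} (a multiset of
-- variable indices) is represented by any list w = (w_1,...,w_k).

-- Coefficient of the monomial x^w in D^(ℓ)(σ)(X_0): number of
-- compatible sequences (a_1..a_n) with multiset {|a_s|} = w.
-- (Entries must satisfy |a_s| ∈ w, so |a_s| ≤ sum w; enumerating only
-- those candidates loses nothing.)
coeffD : {n : ℕ} → Vec (Fin n) n → List ℕ → ℕ
coeffD {n} σ w =
  countB (λ a → compat (le⁺ ltP eqP negP) (le⁻ ltP eqP negP) (oneLine σ) a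
                ∧ msEq (map ∣_∣ a) w)
         (seqs n (cands (sum w)))

-- Coefficient of the monomial x^α y^β in D^(ℓ)(π)(X_0 Y_0), where a
-- sequence of pairs ((i_s,j_s)) has weight ∏ y_{|i_s|} x_{|j_s|}.
coeffDXY : {n : ℕ} → Vec (Fin n) n → List ℕ → List ℕ → ℕ
coeffDXY {n} π α β =
  countB (λ p → compat (le⁺ ltPair eqPair negPair) (le⁻ ltPair eqPair negPair)
                       (oneLine π) p
                ∧ msEq (map (λ ij → ∣ Data.Product.proj₂ ij ∣) p) α
                ∧ msEq (map (λ ij → ∣ Data.Product.proj₁ ij ∣) p) β)
         (seqs n (candPairs (sum α + sum β)))

distinct : {n : ℕ} → List (Fin n) → Bool
distinct []       = true
distinct (x ∷ xs) = not (any (λ y → ⌊ x Fin.≟ y ⌋) xs) ∧ distinct xs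

IsPerm : {n : ℕ} → Vec (Fin n) n → Set
IsPerm π = ∀ i j → lookup π i ≡ lookup π j → i ≡ j
  where open import Relation.Binary.PropositionalEquality using (_≡_)

Sn : (n : ℕ) → List (Vec (Fin n) n)
Sn n = Data.List.filterᵇ (λ v → distinct (toList v)) (vecs n (allFin n))
  where import Data.List

_∘ₚ_ : {n : ℕ} → Vec (Fin n) n → Vec (Fin n) n → Vec (Fin n) n
σ ∘ₚ τ = Vec.map (lookup σ) τ

eqPerm : {n : ℕ} → Vec (Fin n) n → Vec (Fin n) n → Bool
eqPerm σ τ = ⌊ VecP.≡-dec Fin._≟_ σ τ ⌋

coeffRHS : {n : ℕ} → Vec (Fin n) n → List ℕ → List ℕ → ℕ
coeffRHS {n} π α β =
  sum (map (λ σ → sum (map (λ τ →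
         if eqPerm (σ ∘ₚ τ) π then coeffD σ α * coeffD τ β else 0)
       (Sn n))) (Sn n))

-- Write a term of the right-hand side as (σ, τ, a, b) with στ = π, a σ-compatible and
-- b τ-compatible, and send it to the pair sequence p r = (b r , a (τ r)), which has the same weight.
-- Compatibility of a with σ only depends on the keys (a r , σ r) in the order of P^(ℓ) × [n] that
-- compares values first and breaks ties increasingly for nonnegative and decreasingly for negative
-- values: a is σ-compatible exactly when these keys increase with r. So τ is the standardisation of
-- the keys (c r , π r) of the second coordinates c of p, and a finite case check on the up-down order
-- shows that p is π-compatible exactly when its first coordinates are compatible with that
-- standardisation. Standardising the second coordinates of an arbitrary π-compatible pair sequence
-- thus inverts the map, and the two coefficients count the same finite set.
module Submission where

open import Data.Bool using (Bool; true; false; _∧_; _∨_; not; if_then_else_; T?)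
open import Data.Bool.Properties using (T-≡; if-eta)
open import Data.Nat using (ℕ; zero; suc; _+_; _*_; _∸_; _≤_; _<_; z≤n; s≤s; _<ᵇ_; _≡ᵇ_; _/_; _%_)
open import Data.Nat.DivMod using (m≡m%n+[m/n]*n; m%n<n; m*n%n≡0; m*n/n≡m; [m+kn]%n≡m%n; +-distrib-/)
open import Data.Integer using (ℤ; +_; -[1+_]; ∣_∣)
import Data.Integer as ℤ
open import Data.Nat.Properties
open import Data.Nat.ListAction using (sum)
open import Data.Fin using (Fin; toℕ; punchOut) renaming (zero to fzero; suc to fsuc)
import Data.Fin.Properties as Finₚ
open import Data.List using (List; []; _∷_; map; _++_; length; allFin; upTo; concatMap; cartesianProduct; cartesianProductWith)
import Data.List.Properties as Listₚ
open import Data.List.Membership.Propositional using (_∈_; _∉_; _─_)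
open import Data.List.Membership.Propositional.Properties
  using (∈-cartesianProductWith⁺; ∈-cartesianProduct⁺; ∈-cartesianProduct⁻; ∈-filter⁺; ∈-filter⁻; ∈-map⁺; ∈-upTo⁺; ∈-allFin; ∈-++⁺ˡ)
open import Data.List.Relation.Unary.Unique.Propositional.Properties
  using (cartesianProductWith⁺; cartesianProduct⁺; filter⁺; map⁻; upTo⁺; allFin⁺)
open import Data.Vec using (Vec; lookup; toList; tabulate)
import Data.Vec as Vec
import Data.Vec.Properties as Vecₚ
open import Data.Vec.Properties using (lookup∘tabulate)
open import Data.List.Relation.Unary.Any using (here; there)
import Data.List.Relation.Unary.All as All
open import Data.List.Relation.Unary.All.Properties using (All¬⇒¬Any)
open import Data.List.Relation.Unary.Unique.Propositional using (Unique; []; _∷_)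
open import Data.Product using (_×_; _,_; proj₁; proj₂; ∃; uncurry)
open import Data.Empty using (⊥-elim)
open import Function using (_∘_; case_of_; _⇔_; mk⇔; Equivalence)
open import Function.Definitions using (Injective)
open import Relation.Nullary using (¬_; yes; no)
open import Relation.Nullary.Reflects using (ofʸ)
open import Relation.Binary.Definitions using (tri<; tri≈; tri>)
open import Relation.Nullary.Decidable using (⌊_⌋)
open import Data.Bool.ListAction using (any; all; and)
import Data.Fin as Fin
open import Data.Vec.Membership.Propositional.Properties using (∈-lookup; ∈-toList⁺)
open import Relation.Binary.PropositionalEquality
open import Defs

private variable
  A B : Set
  n : ℕ

module _ (p : A → Bool) where

  countB-++ : (xs ys : List A) → countB p (xs ++ ys) ≡ countB p xs + countB p ys
  countB-++ [] ys = refl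
  countB-++ (x ∷ xs) ys with p x
  ... | true  = cong suc (countB-++ xs ys)
  ... | false = countB-++ xs ys

  countB-map : (f : B → A) (xs : List B) → countB p (map f xs) ≡ countB (p ∘ f) xs
  countB-map f [] = refl
  countB-map f (x ∷ xs) with p (f x)
  ... | true  = cong suc (countB-map f xs)
  ... | false = countB-map f xs

  countB-─ : ∀ {x} (xs : List A) (x∈xs : x ∈ xs) → p x ≡ true →
             countB p xs ≡ suc (countB p (xs ─ x∈xs))
  countB-─ (y ∷ xs) (here refl) px rewrite px = refl
  countB-─ (y ∷ xs) (there x∈xs) px with p y
  ... | true  = cong suc (countB-─ xs x∈xs px)
  ... | false = countB-─ xs x∈xs px

countB-cong : {p q : A → Bool} → (∀ x → p x ≡ q x) → (xs : List A) → countB p xs ≡ countB q xs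
countB-cong p≗q [] = refl
countB-cong {q = q} p≗q (x ∷ xs) rewrite p≗q x with q x
... | true  = cong suc (countB-cong p≗q xs)
... | false = countB-cong p≗q xs

countB-false : (xs : List A) → countB (λ _ → false) xs ≡ 0
countB-false [] = refl
countB-false (x ∷ xs) = countB-false xs

length≡countB-true : (xs : List A) → length xs ≡ countB (λ _ → true) xs
length≡countB-true [] = refl
length≡countB-true (x ∷ xs) = cong suc (length≡countB-true xs)

∈-─ : ∀ {x y : A} (xs : List A) (x∈xs : x ∈ xs) → y ∈ xs → y ≢ x → y ∈ xs ─ x∈xs
∈-─ (z ∷ xs) (here refl) (here refl) y≢x = ⊥-elim (y≢x refl)
∈-─ (z ∷ xs) (here refl) (there y∈xs) y≢x = y∈xs
∈-─ (z ∷ xs) (there x∈xs) (here refl) y≢x = here refl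
∈-─ (z ∷ xs) (there x∈xs) (there y∈xs) y≢x = there (∈-─ xs x∈xs y∈xs y≢x)

Counted : (A → Bool) → List A → A → Set
Counted p xs x = x ∈ xs × p x ≡ true

MapsInto : (A → Bool) → List A → (B → Bool) → List B → (A → B) → Set
MapsInto p xs q ys f = ∀ {x} → Counted p xs x → Counted q ys (f x)

InverseOn : (A → Bool) → List A → (A → B) → (B → A) → Set
InverseOn p xs f g = ∀ {x} → Counted p xs x → g (f x) ≡ x

counted-∷ : (p : A → Bool) {x y : A} {xs : List A} → Counted p xs y → Counted p (x ∷ xs) y
counted-∷ p (y∈xs , py) = there y∈xs , py

countB-injection : (p : A → Bool) (q : B → Bool) {xs : List A} (ys : List B) → Unique xs →
                   (f : A → B) (g : B → A) → MapsInto p xs q ys f → InverseOn p xs f g →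
                   countB p xs ≤ countB q ys
countB-injection p q {[]} ys [] f g into inv = z≤n
countB-injection p q {x ∷ xs} ys (x≢xs ∷ xs!) f g into inv with p x in px
... | false = countB-injection p q ys xs! f g (into ∘ counted-∷ p) (inv ∘ counted-∷ p)
... | true  = subst (suc (countB p xs) ≤_) (sym (countB-─ q ys fx∈ys qfx))
                (s≤s (countB-injection p q (ys ─ fx∈ys) xs! f g into′ (inv ∘ counted-∷ p)))
  where
  fx∈ys = proj₁ (into (here refl , px))
  qfx   = proj₂ (into (here refl , px))
  into′ : MapsInto p xs q (ys ─ fx∈ys) f
  into′ {y} c@(y∈xs , _) = ∈-─ ys fx∈ys (proj₁ (into (counted-∷ p c))) fy≢fx , proj₂ (into (counted-∷ p c))
    where
    fy≢fx : f y ≢ f x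
    fy≢fx fy≡fx = All¬⇒¬Any x≢xs (subst (_∈ xs) y≡x y∈xs)
      where y≡x = trans (sym (inv (counted-∷ p c))) (trans (cong g fy≡fx) (inv (here refl , px)))

countB-bijection : (p : A → Bool) (q : B → Bool) {xs : List A} {ys : List B} → Unique xs → Unique ys →
                   (f : A → B) (g : B → A) →
                   MapsInto p xs q ys f → InverseOn p xs f g →
                   MapsInto q ys p xs g → InverseOn q ys g f →
                   countB p xs ≡ countB q ys
countB-bijection p q xs! ys! f g f-into gf≡id g-into fg≡id =
  ≤-antisym (countB-injection p q _ xs! f g f-into gf≡id) (countB-injection q p _ ys! g f g-into fg≡id)

countB-cartesianProduct : (p : A → Bool) (q : B → Bool) (xs : List A) (ys : List B) →
  countB p xs * countB q ys ≡ countB (λ (x , y) → p x ∧ q y) (cartesianProduct xs ys)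
countB-cartesianProduct p q [] ys = refl
countB-cartesianProduct p q (x ∷ xs) ys = begin
  countB p (x ∷ xs) * countB q ys                                          ≡⟨ head+rest ⟩
  countB (λ y → p x ∧ q y) ys + countB pq (cartesianProduct xs ys)          ≡⟨ cong (_+ countB pq (cartesianProduct xs ys)) (sym (countB-map pq (x ,_) ys)) ⟩
  countB pq (map (x ,_) ys) + countB pq (cartesianProduct xs ys)            ≡⟨ sym (countB-++ pq (map (x ,_) ys) _) ⟩
  countB pq (cartesianProduct (x ∷ xs) ys)                                 ∎
  where
  open ≡-Reasoning
  pq = λ ((x , y) : _ × _) → p x ∧ q y
  head+rest : countB p (x ∷ xs) * countB q ys ≡ countB (λ y → p x ∧ q y) ys + countB pq (cartesianProduct xs ys)
  head+rest with p x
  ... | true  = cong (λ k → countB q ys + k) (countB-cartesianProduct p q xs ys)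
  ... | false = trans (countB-cartesianProduct p q xs ys) (cong (_+ countB pq (cartesianProduct xs ys)) (sym (countB-false ys)))

sum-countB : (r : A → B → Bool) (xs : List A) (ys : List B) →
  sum (map (λ x → countB (r x) ys) xs) ≡ countB (uncurry r) (cartesianProduct xs ys)
sum-countB r [] ys = refl
sum-countB r (x ∷ xs) ys = begin
  countB (r x) ys + sum (map (λ x → countB (r x) ys) xs)                           ≡⟨ cong₂ _+_ (sym (countB-map (uncurry r) (x ,_) ys)) (sum-countB r xs ys) ⟩
  countB (uncurry r) (map (x ,_) ys) + countB (uncurry r) (cartesianProduct xs ys) ≡⟨ sym (countB-++ (uncurry r) (map (x ,_) ys) _) ⟩
  countB (uncurry r) (cartesianProduct (x ∷ xs) ys)                                ∎
  where open ≡-Reasoning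

if-countB : (b : Bool) (p : A → Bool) (xs : List A) → (if b then countB p xs else 0) ≡ countB (λ x → b ∧ p x) xs
if-countB true  p xs = refl
if-countB false p xs = sym (countB-false xs)

concatMap-map≡cartesianProductWith : ∀ {C : Set} (f : A → B → C) (xs : List A) (ys : List B) →
  concatMap (λ x → map (f x) ys) xs ≡ cartesianProductWith f xs ys
concatMap-map≡cartesianProductWith f [] ys = refl
concatMap-map≡cartesianProductWith f (x ∷ xs) ys = cong (map (f x) ys ++_) (concatMap-map≡cartesianProductWith f xs ys)

vecs-suc : (k : ℕ) (c : List A) → vecs (suc k) c ≡ cartesianProductWith Vec._∷_ c (vecs k c)
vecs-suc k c = concatMap-map≡cartesianProductWith Vec._∷_ c (vecs k c)

∈-vecs⁺ : {c : List A} (v : Vec A n) → (∀ i → lookup v i ∈ c) → v ∈ vecs n c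
∈-vecs⁺ Vec.[] _ = here refl
∈-vecs⁺ {n = suc n} {c = c} (x Vec.∷ v) v⊆c rewrite vecs-suc n c =
  ∈-cartesianProductWith⁺ Vec._∷_ (v⊆c fzero) (∈-vecs⁺ v (v⊆c ∘ fsuc))

vecs-unique : (k : ℕ) {c : List A} → Unique c → Unique (vecs k c)
vecs-unique zero c! = All.[] ∷ []
vecs-unique (suc k) {c} c! rewrite vecs-suc k c =
  cartesianProductWith⁺ Vec._∷_ (Vecₚ.∷-injective) c! (vecs-unique k c!)

seqs≡map-toList-vecs : (k : ℕ) (c : List A) → seqs k c ≡ map toList (vecs k c)
seqs≡map-toList-vecs zero c = refl
seqs≡map-toList-vecs (suc k) c = sym (begin
  map toList (vecs (suc k) c)                                ≡⟨ Listₚ.map-concatMap toList _ c ⟩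
  concatMap (λ x → map toList (map (x Vec.∷_) (vecs k c))) c ≡⟨ Listₚ.concatMap-cong (λ x → trans (sym (Listₚ.map-∘ (vecs k c))) (Listₚ.map-∘ (vecs k c))) c ⟩
  concatMap (λ x → map (x ∷_) (map toList (vecs k c))) c     ≡⟨ Listₚ.concatMap-cong (λ x → cong (map (x ∷_)) (sym (seqs≡map-toList-vecs k c))) c ⟩
  seqs (suc k) c                                             ∎)
  where open ≡-Reasoning

countB-seqs : (p : List A → Bool) (k : ℕ) (c : List A) → countB p (seqs k c) ≡ countB (p ∘ toList) (vecs k c)
countB-seqs p k c = trans (cong (countB p) (seqs≡map-toList-vecs k c)) (countB-map p toList (vecs k c))

decode-rank : (a : ℤ) → decode (rank a) ≡ a
decode-rank (+ m) rewrite m*n%n≡0 m 2 ⦃ _ ⦄ = cong +_ (m*n/n≡m m 2)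
decode-rank -[1+ m ] rewrite [m+kn]%n≡m%n 1 m 2 ⦃ _ ⦄ =
  cong -[1+_] (trans (+-distrib-/ 1 (m * 2) (subst (λ k → suc k < 2) (sym (m*n%n≡0 m 2)) ≤-refl)) (m*n/n≡m m 2))

rank-injective : ∀ {a b} → rank a ≡ rank b → a ≡ b
rank-injective {a} {b} eq = trans (sym (decode-rank a)) (trans (cong decode eq) (decode-rank b))

rank-decode : (c : ℕ) → rank (decode c) ≡ c
rank-decode c with c % 2 | m%n<n c 2 | m≡m%n+[m/n]*n c 2
... | 0 | _ | c≡ = sym c≡
... | 1 | _ | c≡ = sym c≡
... | suc (suc _) | s≤s (s≤s ()) | _

∈-cands⁺ : (B : ℕ) (a : ℤ) → ∣ a ∣ ≤ B → a ∈ cands B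
∈-cands⁺ B a |a|≤B = subst (_∈ cands B) (decode-rank a) (∈-map⁺ decode (∈-upTo⁺ (rank< a |a|≤B)))
  where
  rank< : (a : ℤ) → ∣ a ∣ ≤ B → rank a < suc (B * 2)
  rank< (+ m) m≤B = s≤s (*-monoˡ-≤ 2 m≤B)
  rank< -[1+ m ] m<B = s≤s (*-monoˡ-< 2 m<B)

cands-unique : (B : ℕ) → Unique (cands B)
cands-unique B = map⁻ (subst Unique (sym (map-rank-cands)) (upTo⁺ _))
  where
  map-rank-cands : map rank (cands B) ≡ upTo (suc (B * 2))
  map-rank-cands = trans (sym (Listₚ.map-∘ (upTo (suc (B * 2))))) (trans (Listₚ.map-cong rank-decode (upTo (suc (B * 2)))) (Listₚ.map-id (upTo (suc (B * 2)))))

candPairs≡cartesianProduct : (B : ℕ) → candPairs B ≡ cartesianProduct (cands B) (cands B)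
candPairs≡cartesianProduct B = concatMap-map≡cartesianProductWith _,_ (cands B) (cands B)

∈-candPairs⁺ : (B : ℕ) (i j : ℤ) → ∣ i ∣ ≤ B → ∣ j ∣ ≤ B → (i , j) ∈ candPairs B
∈-candPairs⁺ B i j |i|≤B |j|≤B rewrite candPairs≡cartesianProduct B =
  ∈-cartesianProduct⁺ (∈-cands⁺ B i |i|≤B) (∈-cands⁺ B j |j|≤B)

candPairs-unique : (B : ℕ) → Unique (candPairs B)
candPairs-unique B rewrite candPairs≡cartesianProduct B = cartesianProduct⁺ (cands-unique B) (cands-unique B)

∈-toList⇒lookup : {v : Vec A n} {x : A} → x ∈ toList v → ∃ λ i → lookup v i ≡ x
∈-toList⇒lookup {v = y Vec.∷ v} (here refl) = fzero , refl
∈-toList⇒lookup {v = y Vec.∷ v} (there x∈v) = let (i , vi≡x) = ∈-toList⇒lookup x∈v in fsuc i , vi≡x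

any-≟≡false⇔∉ : ∀ {m} (x : Fin m) (xs : List (Fin m)) → (any (λ y → ⌊ x Fin.≟ y ⌋) xs ≡ false) ⇔ (x ∉ xs)
any-≟≡false⇔∉ x [] = mk⇔ (λ _ ()) (λ _ → refl)
any-≟≡false⇔∉ x (y ∷ xs) with x Fin.≟ y
... | yes refl = mk⇔ (λ ()) (λ x∉ → ⊥-elim (x∉ (here refl)))
... | no x≢y = mk⇔ (λ e → λ { (here refl) → x≢y refl ; (there x∈xs) → Equivalence.to (any-≟≡false⇔∉ x xs) e x∈xs })
                   (λ x∉ → Equivalence.from (any-≟≡false⇔∉ x xs) (x∉ ∘ there))

module _ {m : ℕ} (x : Fin m) (v : Vec (Fin m) n) where

  injective-∷ : x ∉ toList v → Injective _≡_ _≡_ (lookup v) → Injective _≡_ _≡_ (lookup (x Vec.∷ v))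
  injective-∷ x∉v inj {fzero}  {fzero}  _ = refl
  injective-∷ x∉v inj {fzero}  {fsuc j} x≡vj = ⊥-elim (x∉v (subst (_∈ toList v) (sym x≡vj) (∈-toList⁺ (∈-lookup j v))))
  injective-∷ x∉v inj {fsuc i} {fzero}  vi≡x = ⊥-elim (x∉v (subst (_∈ toList v) vi≡x (∈-toList⁺ (∈-lookup i v))))
  injective-∷ x∉v inj {fsuc i} {fsuc j} vi≡vj = cong fsuc (inj vi≡vj)

  ∉-toList-of-injective : Injective _≡_ _≡_ (lookup (x Vec.∷ v)) → x ∉ toList v
  ∉-toList-of-injective inj x∈v = let (i , vi≡x) = ∈-toList⇒lookup x∈v in 0≢1+n (cong toℕ (inj (sym vi≡x)))

distinct-toList⇔injective : ∀ {m} (v : Vec (Fin m) n) → (distinct (toList v) ≡ true) ⇔ Injective _≡_ _≡_ (lookup v)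
distinct-toList⇔injective Vec.[] = mk⇔ (λ _ {i} → case i of λ ()) (λ _ → refl)
distinct-toList⇔injective (x Vec.∷ v) = mk⇔ to from
  where
  module IH = Equivalence (distinct-toList⇔injective v)
  to : distinct (x ∷ toList v) ≡ true → Injective _≡_ _≡_ (lookup (x Vec.∷ v))
  to d with any (λ y → ⌊ x Fin.≟ y ⌋) (toList v) in x∈?v
  ... | false = injective-∷ x v (Equivalence.to (any-≟≡false⇔∉ x (toList v)) x∈?v) (IH.to d)
  ... | true  = case d of λ ()
  from : Injective _≡_ _≡_ (lookup (x Vec.∷ v)) → distinct (x ∷ toList v) ≡ true
  from inj rewrite Equivalence.from (any-≟≡false⇔∉ x (toList v)) (∉-toList-of-injective x v inj) =
    IH.from (λ vi≡vj → Finₚ.suc-injective (inj vi≡vj))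

∈-Sn⁺ : (v : Vec (Fin n) n) → Injective _≡_ _≡_ (lookup v) → v ∈ Sn n
∈-Sn⁺ {n} v inj = ∈-filter⁺ (T? ∘ distinct ∘ toList)
  (∈-vecs⁺ v (λ i → ∈-allFin (lookup v i)))
  (Equivalence.from T-≡ (Equivalence.from (distinct-toList⇔injective v) inj))

∈-Sn⁻ : {v : Vec (Fin n) n} → v ∈ Sn n → Injective _≡_ _≡_ (lookup v)
∈-Sn⁻ {n} {v} v∈Sn = Equivalence.to (distinct-toList⇔injective v)
  (Equivalence.to T-≡ (proj₂ (∈-filter⁻ (T? ∘ distinct ∘ toList) {xs = vecs n (allFin n)} v∈Sn)))

Sn-unique : (n : ℕ) → Unique (Sn n)
Sn-unique n = filter⁺ (T? ∘ distinct ∘ toList) (vecs-unique n (allFin⁺ n))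

tabulate-≗ : {f : Fin n → A} (v : Vec A n) → (∀ r → f r ≡ lookup v r) → tabulate f ≡ v
tabulate-≗ v f≗v = trans (Vecₚ.tabulate-cong f≗v) (Vecₚ.tabulate∘lookup v)

eqPerm⇔≡ : (σ τ : Vec (Fin n) n) → (eqPerm σ τ ≡ true) ⇔ (σ ≡ τ)
eqPerm⇔≡ σ τ with Vecₚ.≡-dec Fin._≟_ σ τ
... | yes σ≡τ = mk⇔ (λ _ → σ≡τ) (λ _ → refl)
... | no σ≢τ  = mk⇔ (λ ()) (λ σ≡τ → ⊥-elim (σ≢τ σ≡τ))

∧-true : ∀ a {b} → a ∧ b ≡ true → a ≡ true × b ≡ true
∧-true true b≡true = refl , b≡true

∧-intro : ∀ {a b} → a ≡ true → b ≡ true → a ∧ b ≡ true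
∧-intro refl b≡true = b≡true

<ᵇ≡true : ∀ {a b} → a < b → (a <ᵇ b) ≡ true
<ᵇ≡true a<b = Equivalence.to T-≡ (<⇒<ᵇ a<b)

<ᵇ≡false : ∀ {a b} → ¬ a < b → (a <ᵇ b) ≡ false
<ᵇ≡false {a} {b} a≮b with a <ᵇ b | <ᵇ-reflects-< a b
... | true  | ofʸ a<b = ⊥-elim (a≮b a<b)
... | false | _       = refl

<ᵇ≡true⇒< : ∀ {a b} → (a <ᵇ b) ≡ true → a < b
<ᵇ≡true⇒< {a} {b} e = <ᵇ⇒< a b (Equivalence.from T-≡ e)

<ᵇ-irrefl : (a : ℕ) → (a <ᵇ a) ≡ false
<ᵇ-irrefl a = <ᵇ≡false {a} (<-irrefl refl)

+-<ᵇ-cancelˡ : ∀ m {a b} → (m + a <ᵇ m + b) ≡ (a <ᵇ b)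
+-<ᵇ-cancelˡ zero    = refl
+-<ᵇ-cancelˡ (suc m) = +-<ᵇ-cancelˡ m

<ᵇ-flip : ∀ {p p′} → p ≢ p′ → (p′ <ᵇ p) ≡ not (p <ᵇ p′)
<ᵇ-flip {p} {p′} p≢p′ with <-cmp p p′
... | tri< p<p′ _ _ rewrite <ᵇ≡false (<-asym p<p′) | <ᵇ≡true p<p′ = refl
... | tri≈ _ p≡p′ _ = ⊥-elim (p≢p′ p≡p′)
... | tri> _ _ p′<p rewrite <ᵇ≡true p′<p | <ᵇ≡false (<-asym p′<p) = refl

<ᵇ-transport : {X : Set} (f g : X → ℕ) → (∀ x y → f x < f y → g x < g y) → (∀ x y → f x ≡ f y → g x ≡ g y) →
               ∀ x y → (g x <ᵇ g y) ≡ (f x <ᵇ f y)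
<ᵇ-transport f g mono cong≡ x y with <-cmp (f x) (f y)
... | tri< fx<fy _ _ = trans (<ᵇ≡true (mono x y fx<fy)) (sym (<ᵇ≡true fx<fy))
... | tri≈ _ fx≡fy _ = trans (cong (g x <ᵇ_) (sym (cong≡ x y fx≡fy))) (trans (<ᵇ-irrefl (g x)) (sym (<ᵇ≡false (<-irrefl fx≡fy))))
... | tri> _ _ fy<fx = trans (<ᵇ≡false (<-asym (mono y x fy<fx))) (sym (<ᵇ≡false (<-asym fy<fx)))

-- Injective endomaps of Fin n

injective⇒surjective : {f : Fin n → Fin n} → Injective _≡_ _≡_ f → ∀ k → ∃ λ r → f r ≡ k
injective⇒surjective {suc n} {f} f-inj k with Finₚ.any? (λ r → f r Fin.≟ k)
... | yes hit = hit
... | no miss = ⊥-elim (1+n≰n (Finₚ.injective⇒≤ {f = f′} f′-inj))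
  where
  f′ : Fin (suc n) → Fin n
  f′ r = punchOut {i = k} (λ k≡fr → miss (r , sym k≡fr))
  f′-inj : Injective _≡_ _≡_ f′
  f′-inj {i} {j} = f-inj ∘ Finₚ.punchOut-injective {i = k} (λ k≡fi → miss (i , sym k≡fi)) (λ k≡fj → miss (j , sym k≡fj))

module Inverse {f : Fin n → Fin n} (f-inj : Injective _≡_ _≡_ f) where

  f⁻¹ : Fin n → Fin n
  f⁻¹ k = proj₁ (injective⇒surjective f-inj k)

  f∘f⁻¹ : ∀ k → f (f⁻¹ k) ≡ k
  f∘f⁻¹ k = proj₂ (injective⇒surjective f-inj k)

  f⁻¹∘f : ∀ r → f⁻¹ (f r) ≡ r
  f⁻¹∘f r = f-inj (f∘f⁻¹ (f r))

  f⁻¹-injective : Injective _≡_ _≡_ f⁻¹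
  f⁻¹-injective {k} {k′} e = trans (sym (f∘f⁻¹ k)) (trans (cong f e) (f∘f⁻¹ k′))

countB-reindex : (p : Fin n → Bool) {f : Fin n → Fin n} → Injective _≡_ _≡_ f →
                 countB (p ∘ f) (allFin n) ≡ countB p (allFin n)
countB-reindex {n} p {f} f-inj =
  countB-bijection (p ∘ f) p (allFin⁺ n) (allFin⁺ n) f f⁻¹
    (λ (_ , pfr) → ∈-allFin _ , pfr) (λ _ → f⁻¹∘f _)
    (λ {k} (_ , pk) → ∈-allFin _ , subst (λ j → p j ≡ true) (sym (f∘f⁻¹ k)) pk) (λ _ → f∘f⁻¹ _)
  where open Inverse f-inj

countB-mono : (p q : A → Bool) (xs : List A) → (∀ x → p x ≡ true → q x ≡ true) → countB p xs ≤ countB q xs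
countB-mono p q [] p⇒q = z≤n
countB-mono p q (x ∷ xs) p⇒q with p x in px | q x in qx
... | true  | true  = s≤s (countB-mono p q xs p⇒q)
... | true  | false = case trans (sym (p⇒q x px)) qx of λ ()
... | false | true  = m≤n⇒m≤1+n (countB-mono p q xs p⇒q)
... | false | false = countB-mono p q xs p⇒q

countB-mono-< : (p q : A → Bool) {x : A} (xs : List A) → (∀ x → p x ≡ true → q x ≡ true) →
                x ∈ xs → p x ≡ false → q x ≡ true → countB p xs < countB q xs
countB-mono-< p q (y ∷ xs) p⇒q (here refl) px qx rewrite px | qx = s≤s (countB-mono p q xs p⇒q)
countB-mono-< p q (y ∷ xs) p⇒q (there x∈xs) px qx with p y in py | q y in qy
... | true  | true  = s≤s (countB-mono-< p q xs p⇒q x∈xs px qx)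
... | true  | false = case trans (sym (p⇒q y py)) qy of λ ()
... | false | true  = m≤n⇒m≤1+n (countB-mono-< p q xs p⇒q x∈xs px qx)
... | false | false = countB-mono-< p q xs p⇒q x∈xs px qx

countB-true-allFin : (n : ℕ) → countB (λ _ → true) (allFin n) ≡ n
countB-true-allFin n = trans (sym (length≡countB-true (allFin n))) (Listₚ.length-tabulate (λ k → k))

countB-below : (n m : ℕ) → m ≤ n → countB (λ k → toℕ k <ᵇ m) (allFin n) ≡ m
countB-below n zero _ = countB-false (allFin n)
countB-below (suc n) (suc m) (s≤s m≤n) = cong suc (begin
  countB (λ k → toℕ k <ᵇ suc m) (Data.List.tabulate {n = n} fsuc) ≡⟨ cong (countB (λ k → toℕ k <ᵇ suc m)) (sym (Listₚ.map-tabulate {n = n} (λ k → k) fsuc)) ⟩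
  countB (λ k → toℕ k <ᵇ suc m) (map fsuc (allFin n))          ≡⟨ countB-map _ fsuc (allFin n) ⟩
  countB (λ k → toℕ k <ᵇ m) (allFin n)                         ≡⟨ countB-below n m m≤n ⟩
  m                                                            ∎)
  where open ≡-Reasoning

module Standardisation (key : Fin n → ℕ) (key-inj : Injective _≡_ _≡_ key) where

  below : Fin n → Fin n → Bool
  below r r′ = key r′ <ᵇ key r

  std : Fin n → Fin n
  std r = Fin.fromℕ< (subst (countB (below r) (allFin n) <_) (countB-true-allFin n)
                        (countB-mono-< (below r) (λ _ → true) (allFin n) (λ _ _ → refl) (∈-allFin r) (<ᵇ-irrefl (key r)) refl))

  toℕ-std : ∀ r → toℕ (std r) ≡ countB (below r) (allFin n)
  toℕ-std r = Finₚ.toℕ-fromℕ< _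

  std-mono : ∀ r r′ → key r < key r′ → toℕ (std r) < toℕ (std r′)
  std-mono r r′ k<k′ = subst₂ _<_ (sym (toℕ-std r)) (sym (toℕ-std r′))
    (countB-mono-< (below r) (below r′) (allFin n) (λ s s<r → <ᵇ≡true (<-trans (<ᵇ≡true⇒< s<r) k<k′))
                   (∈-allFin r) (<ᵇ-irrefl (key r)) (<ᵇ≡true k<k′))

  std-<ᵇ : ∀ r r′ → (toℕ (std r) <ᵇ toℕ (std r′)) ≡ (key r <ᵇ key r′)
  std-<ᵇ = <ᵇ-transport key (toℕ ∘ std) std-mono (λ r r′ k≡k′ → cong (toℕ ∘ std) (key-inj k≡k′))

  std-injective : Injective _≡_ _≡_ std
  std-injective {r} {r′} e with <-cmp (key r) (key r′)
  ... | tri< k<k′ _ _ = ⊥-elim (<-irrefl (cong toℕ e) (std-mono r r′ k<k′))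
  ... | tri≈ _ k≡k′ _ = key-inj k≡k′
  ... | tri> _ _ k′<k = ⊥-elim (<-irrefl (cong toℕ (sym e)) (std-mono r′ r k′<k))

  std-unique : {t : Fin n → Fin n} → Injective _≡_ _≡_ t →
               (∀ r r′ → (toℕ (t r) <ᵇ toℕ (t r′)) ≡ (key r <ᵇ key r′)) → ∀ r → std r ≡ t r
  std-unique {t} t-inj t-order r = Finₚ.toℕ-injective (begin
    toℕ (std r)                                              ≡⟨ toℕ-std r ⟩
    countB (below r) (allFin n)                              ≡⟨ countB-cong (λ r′ → sym (t-order r′ r)) (allFin n) ⟩
    countB ((λ k → toℕ k <ᵇ toℕ (t r)) ∘ t) (allFin n)       ≡⟨ countB-reindex (λ k → toℕ k <ᵇ toℕ (t r)) t-inj ⟩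
    countB (λ k → toℕ k <ᵇ toℕ (t r)) (allFin n)             ≡⟨ countB-below n (toℕ (t r)) (<⇒≤ (Finₚ.toℕ<n (t r))) ⟩
    toℕ (t r)                                                ∎)
    where open ≡-Reasoning

all≡countB-not≡ᵇ0 : (p : A → Bool) (xs : List A) → all p xs ≡ (countB (not ∘ p) xs ≡ᵇ 0)
all≡countB-not≡ᵇ0 p [] = refl
all≡countB-not≡ᵇ0 p (x ∷ xs) with p x
... | true  = all≡countB-not≡ᵇ0 p xs
... | false = refl

all-++ : (p : A → Bool) (xs ys : List A) → all p (xs ++ ys) ≡ all p xs ∧ all p ys
all-++ p [] ys = refl
all-++ p (x ∷ xs) ys with p x
... | true  = all-++ p xs ys
... | false = refl

all-cong : {p q : A → Bool} → (∀ x → p x ≡ q x) → (xs : List A) → all p xs ≡ all q xs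
all-cong p≗q xs = cong and (Listₚ.map-cong p≗q xs)

all⇒∈⇒ : (p : A → Bool) {xs : List A} → all p xs ≡ true → ∀ {x} → x ∈ xs → p x ≡ true
all⇒∈⇒ p {y ∷ xs} all-p (here refl) with p y
... | true = refl
all⇒∈⇒ p {y ∷ xs} all-p (there x∈xs) with p y
... | true = all⇒∈⇒ p all-p x∈xs

SameCounts : List ℕ → List ℕ → Set
SameCounts u u′ = ∀ q → countB q u ≡ countB q u′

msEq-cong : (u u′ : List ℕ) → SameCounts u u′ → (w : List ℕ) → msEq u w ≡ msEq u′ w
msEq-cong u u′ same w = cong₂ _∧_ same-length (begin
  all P (u ++ w)                            ≡⟨ all-++ P u w ⟩
  all P u ∧ all P w                         ≡⟨ cong (_∧ all P w) (all≡countB-not≡ᵇ0 P u) ⟩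
  (countB (not ∘ P) u ≡ᵇ 0) ∧ all P w       ≡⟨ cong (λ c → (c ≡ᵇ 0) ∧ all P w) (same (not ∘ P)) ⟩
  (countB (not ∘ P) u′ ≡ᵇ 0) ∧ all P w      ≡⟨ cong (_∧ all P w) (sym (all≡countB-not≡ᵇ0 P u′)) ⟩
  all P u′ ∧ all P w                        ≡⟨ sym (all-++ P u′ w) ⟩
  all P (u′ ++ w)                           ≡⟨ all-cong (λ k → cong (_≡ᵇ countN k w) (same _)) (u′ ++ w) ⟩
  all P′ (u′ ++ w)                          ∎)
  where
  open ≡-Reasoning
  P P′ : ℕ → Bool
  P  k = countN k u  ≡ᵇ countN k w
  P′ k = countN k u′ ≡ᵇ countN k w
  same-length : (length u ≡ᵇ length w) ≡ (length u′ ≡ᵇ length w)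
  same-length = cong (_≡ᵇ _) (trans (length≡countB-true u) (trans (same _) (sym (length≡countB-true u′))))

countN-pos : (k : ℕ) {u : List ℕ} → k ∈ u → 0 < countN k u
countN-pos k {y ∷ u} (here refl) rewrite Equivalence.to T-≡ (≡⇒≡ᵇ k k refl) = s≤s z≤n
countN-pos k {y ∷ u} (there k∈u) with y ≡ᵇ k
... | true  = s≤s z≤n
... | false = countN-pos k k∈u

countN-pos⇒≤sum : (k : ℕ) (u : List ℕ) → 0 < countN k u → k ≤ sum u
countN-pos⇒≤sum k (y ∷ u) pos with y ≡ᵇ k in y≟k
... | true  rewrite ≡ᵇ⇒≡ y k (Equivalence.from T-≡ y≟k) = m≤m+n k (sum u)
... | false = ≤-trans (countN-pos⇒≤sum k u pos) (m≤n+m (sum u) y)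

msEq⇒≤sum : (u w : List ℕ) → msEq u w ≡ true → ∀ {k} → k ∈ u → k ≤ sum w
msEq⇒≤sum u w eq {k} k∈u = countN-pos⇒≤sum k w (subst (0 <_) same-count (countN-pos k k∈u))
  where
  same-count : countN k u ≡ countN k w
  same-count = ≡ᵇ⇒≡ _ _ (Equivalence.from T-≡
    (all⇒∈⇒ (λ k → countN k u ≡ᵇ countN k w) (proj₂ (∧-true (length u ≡ᵇ length w) eq)) (∈-++⁺ˡ k∈u)))

map-toList≡tabulate : (h : A → B) (v : Vec A n) → map h (toList v) ≡ Data.List.tabulate (h ∘ lookup v)
map-toList≡tabulate h Vec.[] = refl
map-toList≡tabulate h (x Vec.∷ v) = cong (h x ∷_) (map-toList≡tabulate h v)

countB-map-toList : (q : ℕ → Bool) (h : A → ℕ) (v : Vec A n) → countB q (map h (toList v)) ≡ countB (q ∘ h ∘ lookup v) (allFin n)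
countB-map-toList {n = n} q h v = begin
  countB q (map h (toList v))                          ≡⟨ cong (countB q) (map-toList≡tabulate h v) ⟩
  countB q (Data.List.tabulate (h ∘ lookup v))         ≡⟨ cong (countB q) (sym (Listₚ.map-tabulate (λ k → k) (h ∘ lookup v))) ⟩
  countB q (map (h ∘ lookup v) (allFin n))             ≡⟨ countB-map q (h ∘ lookup v) (allFin n) ⟩
  countB (q ∘ h ∘ lookup v) (allFin n)                 ∎
  where open ≡-Reasoning

msEq-reindex : {t : Fin n → Fin n} → Injective _≡_ _≡_ t → (h : A → ℕ) (h′ : B → ℕ) (v : Vec A n) (v′ : Vec B n) →
               (∀ r → h (lookup v r) ≡ h′ (lookup v′ (t r))) → (w : List ℕ) →
               msEq (map h (toList v)) w ≡ msEq (map h′ (toList v′)) w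
msEq-reindex {n = n} {t = t} t-inj h h′ v v′ v≡v′∘t = msEq-cong (map h (toList v)) (map h′ (toList v′)) λ q → begin
  countB q (map h (toList v))               ≡⟨ countB-map-toList q h v ⟩
  countB (q ∘ h ∘ lookup v) (allFin n)       ≡⟨ countB-cong (cong q ∘ v≡v′∘t) (allFin n) ⟩
  countB (q ∘ h′ ∘ lookup v′ ∘ t) (allFin n) ≡⟨ countB-reindex (q ∘ h′ ∘ lookup v′) t-inj ⟩
  countB (q ∘ h′ ∘ lookup v′) (allFin n)     ≡⟨ sym (countB-map-toList q h′ v′) ⟩
  countB q (map h′ (toList v′))             ∎
  where open ≡-Reasoning

∈-map-toList : (h : A → B) (v : Vec A n) (r : Fin n) → h (lookup v r) ∈ map h (toList v)
∈-map-toList h v r = ∈-map⁺ h (∈-toList⁺ (∈-lookup r v))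

stepBy : {X : Set} → (X → X → Bool) → (X → X → Bool) → ℕ → ℕ → X → X → Bool
stepBy l⁺ l⁻ p q a b = if q <ᵇ p then l⁻ a b else l⁺ a b

Consecutive : Fin n → Fin n → Set
Consecutive i j = toℕ j ≡ suc (toℕ i)

consecutive⇒toℕ≢ : {f : Fin n → Fin n} → Injective _≡_ _≡_ f → ∀ {i j} → Consecutive i j → toℕ (f i) ≢ toℕ (f j)
consecutive⇒toℕ≢ f-inj {i} {j} i→j fi≡fj = 1+n≢n (trans (sym i→j) (cong toℕ (sym (f-inj (Finₚ.toℕ-injective fi≡fj)))))

module _ {X : Set} (l⁺ l⁻ : X → X → Bool) where

  record StepsAlong (s : Fin n → ℕ) (a : Fin n → X) : Set where
    constructor stepsAlong
    field step : ∀ i j → Consecutive i j → stepBy l⁺ l⁻ (s i) (s j) (a i) (a j) ≡ true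

  compat⇒step : (ps : Vec ℕ n) (xs : Vec X n) → compat l⁺ l⁻ (toList ps) (toList xs) ≡ true →
                ∀ i j → Consecutive i j → stepBy l⁺ l⁻ (lookup ps i) (lookup ps j) (lookup xs i) (lookup xs j) ≡ true
  compat⇒step (p Vec.∷ q Vec.∷ ps) (x Vec.∷ y Vec.∷ xs) ok fzero (fsuc fzero) refl = proj₁ (∧-true (stepBy l⁺ l⁻ p q x y) ok)
  compat⇒step (p Vec.∷ q Vec.∷ ps) (x Vec.∷ y Vec.∷ xs) ok (fsuc i) (fsuc j) i→j =
    compat⇒step (q Vec.∷ ps) (y Vec.∷ xs) (proj₂ (∧-true (stepBy l⁺ l⁻ p q x y) ok)) i j (suc-injective i→j)

  steps⇒compat : (ps : Vec ℕ n) (xs : Vec X n) → StepsAlong (lookup ps) (lookup xs) → compat l⁺ l⁻ (toList ps) (toList xs) ≡ true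
  steps⇒compat Vec.[] Vec.[] _ = refl
  steps⇒compat (p Vec.∷ Vec.[]) (x Vec.∷ Vec.[]) _ = refl
  steps⇒compat (p Vec.∷ q Vec.∷ ps) (x Vec.∷ y Vec.∷ xs) (stepsAlong step) =
    ∧-intro (step fzero (fsuc fzero) refl) (steps⇒compat (q Vec.∷ ps) (y Vec.∷ xs) (stepsAlong λ i j i→j → step (fsuc i) (fsuc j) (cong suc i→j)))

  steps-cong : ∀ {s s′ : Fin n → ℕ} {a a′ : Fin n → X} → s ≗ s′ → a ≗ a′ → StepsAlong s a → StepsAlong s′ a′
  steps-cong {s = s} {s′ = s′} {a = a} {a′ = a′} s≗s′ a≗a′ (stepsAlong step) = stepsAlong step′
    where
    step′ : ∀ i j → Consecutive i j → stepBy l⁺ l⁻ (s′ i) (s′ j) (a′ i) (a′ j) ≡ true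
    step′ i j i→j rewrite sym (s≗s′ i) | sym (s≗s′ j) | sym (a≗a′ i) | sym (a≗a′ j) = step i j i→j

  steps-tabulate : (s : Fin n → ℕ) (f : Fin n → X) → StepsAlong s f → StepsAlong s (lookup (tabulate f))
  steps-tabulate s f = steps-cong (λ _ → refl) (λ r → sym (lookup∘tabulate f r))

  compatible⇔steps : (σ : Vec (Fin n) n) (xs : Vec X n) →
    (compat l⁺ l⁻ (oneLine σ) (toList xs) ≡ true) ⇔ StepsAlong (toℕ ∘ lookup σ) (lookup xs)
  compatible⇔steps σ xs = mk⇔
    (steps-cong (λ i → Vecₚ.lookup-map i toℕ σ) (λ _ → refl) ∘ stepsAlong ∘ compat⇒step labels xs ∘ subst Compatible (sym oneLine≡))
    (subst Compatible oneLine≡ ∘ steps⇒compat labels xs ∘ steps-cong (λ i → sym (Vecₚ.lookup-map i toℕ σ)) (λ _ → refl))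
    where
    labels = Vec.map toℕ σ
    Compatible : List ℕ → Set
    Compatible ps = compat l⁺ l⁻ ps (toList xs) ≡ true
    oneLine≡ : toList labels ≡ oneLine σ
    oneLine≡ = Vecₚ.toList-map toℕ σ

module _ {X : Set} (lt eq : X → X → Bool) (neg : X → Bool) where

  stepBy-lt : ∀ p q x y → lt x y ≡ true → stepBy (le⁺ lt eq neg) (le⁻ lt eq neg) p q x y ≡ true
  stepBy-lt p q x y x<y rewrite x<y = if-eta (q <ᵇ p)

  stepBy-gt : ∀ p q x y → lt x y ≡ false → eq x y ≡ false → stepBy (le⁺ lt eq neg) (le⁻ lt eq neg) p q x y ≡ false
  stepBy-gt p q x y x≮y x≠y rewrite x≮y | x≠y = if-eta (q <ᵇ p)

  stepBy-refl : ∀ p q x → lt x x ≡ false → eq x x ≡ true →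
                stepBy (le⁺ lt eq neg) (le⁻ lt eq neg) p q x x ≡ (if q <ᵇ p then neg x else not (neg x))
  stepBy-refl p q x x≮x x≈x rewrite x≮x | x≈x = refl

stepℤ : ℕ → ℕ → ℤ → ℤ → Bool
stepℤ = stepBy (le⁺ ltP eqP negP) (le⁻ ltP eqP negP)

stepPair : ℕ → ℕ → ℤ × ℤ → ℤ × ℤ → Bool
stepPair = stepBy (le⁺ ltPair eqPair negPair) (le⁻ ltPair eqPair negPair)

eqP-refl : (x : ℤ) → eqP x x ≡ true
eqP-refl x with x ℤ.≟ x
... | yes _   = refl
... | no x≢x = ⊥-elim (x≢x refl)

eqP-false : {x y : ℤ} → x ≢ y → eqP x y ≡ false
eqP-false {x} {y} x≢y with x ℤ.≟ y
... | yes x≡y = ⊥-elim (x≢y x≡y)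
... | no _    = refl

data Trichotomyᵇ : Bool → Bool → Bool → Set where
  less    : Trichotomyᵇ true  false false
  equal   : Trichotomyᵇ false true  false
  greater : Trichotomyᵇ false false true

compareP : (x y : ℤ) → Trichotomyᵇ (ltP x y) (eqP x y) (ltP y x)
compareP x y with x ℤ.≟ y
... | yes refl rewrite <ᵇ-irrefl (rank x) = equal
... | no x≢y with <-cmp (rank x) (rank y)
...   | tri< x<y _ _ rewrite <ᵇ≡true x<y | <ᵇ≡false (<-asym x<y) = less
...   | tri≈ _ rx≡ry _ = ⊥-elim (x≢y (rank-injective rx≡ry))
...   | tri> _ _ y<x rewrite <ᵇ≡true y<x | <ᵇ≡false (<-asym y<x) = greater

-- b and c are compared through their Trichotomyᵇ views, nb and nc are their signs, d is the
-- descent bit of the labels of the pairs and e the descent bit of the labels of the first coordinates.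
stepPair-truthTable : ∀ {Lb Eb Gb Lc Ec Gc} → Trichotomyᵇ Lb Eb Gb → Trichotomyᵇ Lc Ec Gc → ∀ nb nc d e →
  e ≡ not (if d then Lc ∨ (Ec ∧ nc) else Lc ∨ (Ec ∧ not nc)) →
  (if d then (Lb ∨ (Eb ∧ ((not nb ∧ Lc) ∨ (nb ∧ Gc)))) ∨ ((Eb ∧ Ec) ∧ ((nb ∧ not nc) ∨ (not nb ∧ nc)))
        else (Lb ∨ (Eb ∧ ((not nb ∧ Lc) ∨ (nb ∧ Gc)))) ∨ ((Eb ∧ Ec) ∧ not ((nb ∧ not nc) ∨ (not nb ∧ nc))))
  ≡ (if e then Lb ∨ (Eb ∧ nb) else Lb ∨ (Eb ∧ not nb))
stepPair-truthTable less    _       nb    nc    d     e _    = trans (if-eta d) (sym (if-eta e))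
stepPair-truthTable greater _       nb    nc    d     e _    = trans (if-eta d) (sym (if-eta e))
stepPair-truthTable equal   less    true  nc    true  _ refl = refl
stepPair-truthTable equal   less    true  nc    false _ refl = refl
stepPair-truthTable equal   less    false nc    true  _ refl = refl
stepPair-truthTable equal   less    false nc    false _ refl = refl
stepPair-truthTable equal   greater true  nc    true  _ refl = refl
stepPair-truthTable equal   greater true  nc    false _ refl = refl
stepPair-truthTable equal   greater false nc    true  _ refl = refl
stepPair-truthTable equal   greater false nc    false _ refl = refl
stepPair-truthTable equal   equal   true  true  true  _ refl = refl
stepPair-truthTable equal   equal   true  true  false _ refl = refl
stepPair-truthTable equal   equal   true  false true  _ refl = refl
stepPair-truthTable equal   equal   true  false false _ refl = refl
stepPair-truthTable equal   equal   false true  true  _ refl = refl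
stepPair-truthTable equal   equal   false true  false _ refl = refl
stepPair-truthTable equal   equal   false false true  _ refl = refl
stepPair-truthTable equal   equal   false false false _ refl = refl

stepPair≡stepℤ : ∀ p p′ q q′ b b′ c c′ → (q′ <ᵇ q) ≡ not (stepℤ p p′ c c′) →
                 stepPair p p′ (b , c) (b′ , c′) ≡ stepℤ q q′ b b′
stepPair≡stepℤ p p′ q q′ b b′ c c′ =
  stepPair-truthTable (compareP b b′) (compareP c c′) (negP b) (negP c) (p′ <ᵇ p) (q′ <ᵇ q)

lex-< : ∀ n {a a′ s s′} → a < a′ → s < n → a * n + s < a′ * n + s′
lex-< n {a} {a′} {s} {s′} a<a′ s<n = begin-strict
  a * n + s     <⟨ +-monoʳ-< (a * n) s<n ⟩
  a * n + n     ≡⟨ +-comm (a * n) n ⟩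
  suc a * n     ≤⟨ *-monoˡ-≤ n a<a′ ⟩
  a′ * n        ≤⟨ m≤m+n (a′ * n) s′ ⟩
  a′ * n + s′   ∎
  where open ≤-Reasoning

∸-<ᵇ-flip : ∀ {n p p′} → p < n → p′ < n → (p′ <ᵇ p) ≡ (n ∸ suc p <ᵇ n ∸ suc p′)
∸-<ᵇ-flip {n} {p} {p′} p<n p′<n with <-cmp p p′
... | tri< p<p′ _ _ = trans (<ᵇ≡false (<-asym p<p′)) (sym (<ᵇ≡false (<-asym (∸-monoʳ-< (s≤s p<p′) p′<n))))
... | tri≈ _ refl _ = trans (<ᵇ-irrefl p) (sym (<ᵇ-irrefl (n ∸ suc p)))
... | tri> _ _ p′<p = trans (<ᵇ≡true p′<p) (sym (<ᵇ≡true (∸-monoʳ-< (s≤s p′<p) p<n)))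

tiebreak : ℕ → ℤ → ℕ → ℕ
tiebreak n c p = if negP c then n ∸ suc p else p

tiebreak<n : ∀ {n} c {p} → p < n → tiebreak n c p < n
tiebreak<n {suc n} c {p} p<n with negP c
... | true  = s≤s (m∸n≤m n p)
... | false = p<n

-- Position of (c , p) in the order of P^(ℓ) × [0, n) that compares c first and then p,
-- increasingly when c is nonnegative and decreasingly when c is negative.
tieKey : ℕ → ℤ → ℕ → ℕ
tieKey n c p = rank c * n + tiebreak n c p

stepℤ≡tieKey<ᵇ : ∀ {n p p′} c c′ → p < n → p′ < n → p ≢ p′ → stepℤ p p′ c c′ ≡ (tieKey n c p <ᵇ tieKey n c′ p′)
stepℤ≡tieKey<ᵇ {n} {p} {p′} c c′ p<n p′<n p≢p′ with <-cmp (rank c) (rank c′)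
... | tri< c<c′ _ _ = trans (stepBy-lt ltP eqP negP p p′ c c′ (<ᵇ≡true c<c′)) (sym (<ᵇ≡true (lex-< n c<c′ (tiebreak<n c p<n))))
... | tri> _ _ c′<c = trans (stepBy-gt ltP eqP negP p p′ c c′ (<ᵇ≡false (<-asym c′<c)) (eqP-false λ c≡c′ → <-irrefl (cong rank (sym c≡c′)) c′<c))
                            (sym (<ᵇ≡false (<-asym (lex-< n c′<c (tiebreak<n c′ p′<n)))))
... | tri≈ _ rc≡rc′ _ with rank-injective {c} {c′} rc≡rc′
...   | refl = begin
  stepℤ p p′ c c                                        ≡⟨ stepBy-refl ltP eqP negP p p′ c (<ᵇ-irrefl (rank c)) (eqP-refl c) ⟩
  (if p′ <ᵇ p then negP c else not (negP c))            ≡⟨ same-value-tie (negP c) ⟩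
  (tiebreak n c p <ᵇ tiebreak n c p′)                   ≡⟨ sym (+-<ᵇ-cancelˡ (rank c * n)) ⟩
  (tieKey n c p <ᵇ tieKey n c p′)                       ∎
  where
  open ≡-Reasoning
  same-value-tie : ∀ b → (if p′ <ᵇ p then b else not b) ≡ ((if b then n ∸ suc p else p) <ᵇ (if b then n ∸ suc p′ else p′))
  same-value-tie true  with p′ <ᵇ p | ∸-<ᵇ-flip p<n p′<n
  ... | true  | flip = flip
  ... | false | flip = flip
  same-value-tie false rewrite <ᵇ-flip p≢p′ with p <ᵇ p′
  ... | true  = refl
  ... | false = refl

tieKey-injective : ∀ {n p p′} c c′ → p < n → p′ < n → tieKey n c p ≡ tieKey n c′ p′ → c ≡ c′ × p ≡ p′
tieKey-injective {n} {p} {p′} c c′ p<n p′<n k≡k′ with <-cmp (rank c) (rank c′)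
... | tri< c<c′ _ _ = ⊥-elim (<-irrefl k≡k′ (lex-< n c<c′ (tiebreak<n c p<n)))
... | tri> _ _ c′<c = ⊥-elim (<-irrefl (sym k≡k′) (lex-< n c′<c (tiebreak<n c′ p′<n)))
... | tri≈ _ rc≡rc′ _ with rank-injective {c} {c′} rc≡rc′
...   | refl = refl , tiebreak-injective (negP c) (+-cancelˡ-≡ (rank c * n) _ _ k≡k′)
  where
  tiebreak-injective : ∀ b → (if b then n ∸ suc p else p) ≡ (if b then n ∸ suc p′ else p′) → p ≡ p′
  tiebreak-injective true  e = suc-injective (∸-cancelˡ-≡ p<n p′<n e)
  tiebreak-injective false e = e

consecutive-<⇒< : (f : Fin n → ℕ) → (∀ i j → Consecutive i j → f i < f j) → ∀ i j → toℕ i < toℕ j → f i < f j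
consecutive-<⇒< {n} f step i j i<j = go (toℕ j ∸ suc (toℕ i)) j (sym (m∸n+n≡m i<j))
  where
  go : ∀ d j → toℕ j ≡ d + suc (toℕ i) → f i < f j
  go zero    j j≡ = step i j j≡
  go (suc d) j j≡ = <-trans (go d k (Finₚ.toℕ-fromℕ< k<n)) (step k j (trans j≡ (cong suc (sym (Finₚ.toℕ-fromℕ< k<n)))))
    where
    k<n : d + suc (toℕ i) < n
    k<n = <-trans (n<1+n _) (subst (_< n) j≡ (Finₚ.toℕ<n j))
    k = Fin.fromℕ< k<n

StepsAlongℤ : (Fin n → ℕ) → (Fin n → ℤ) → Set
StepsAlongℤ = StepsAlong (le⁺ ltP eqP negP) (le⁻ ltP eqP negP)

keyAlong : (Fin n → Fin n) → (Fin n → ℤ) → Fin n → ℕ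
keyAlong {n} s a r = tieKey n (a r) (toℕ (s r))

keyAlong-injective : {s : Fin n → Fin n} → Injective _≡_ _≡_ s → (a : Fin n → ℤ) → Injective _≡_ _≡_ (keyAlong s a)
keyAlong-injective {s = s} s-inj a {r} {r′} k≡k′ =
  s-inj (Finₚ.toℕ-injective (proj₂ (tieKey-injective (a r) (a r′) (Finₚ.toℕ<n (s r)) (Finₚ.toℕ<n (s r′)) k≡k′)))

OrderedBy : (Fin n → ℕ) → Set
OrderedBy {n} key = ∀ (x y : Fin n) → (key x <ᵇ key y) ≡ (toℕ x <ᵇ toℕ y)

steps⇔orderedBy-keyAlong : {s : Fin n → Fin n} → Injective _≡_ _≡_ s → (a : Fin n → ℤ) →
                          StepsAlongℤ (toℕ ∘ s) a ⇔ OrderedBy (keyAlong s a)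
steps⇔orderedBy-keyAlong {n} {s} s-inj a = mk⇔
  (λ steps → <ᵇ-transport toℕ (keyAlong s a)
     (consecutive-<⇒< (keyAlong s a) (λ i j i→j → <ᵇ≡true⇒< (trans (sym (step≡ i j i→j)) (StepsAlong.step steps i j i→j))))
     (λ x y x≡y → cong (keyAlong s a) (Finₚ.toℕ-injective x≡y)))
  (λ ordered → stepsAlong λ i j i→j → trans (step≡ i j i→j) (trans (ordered i j) (<ᵇ≡true (subst (toℕ i <_) (sym i→j) ≤-refl))))
  where
  step≡ : ∀ i j → Consecutive i j → stepℤ (toℕ (s i)) (toℕ (s j)) (a i) (a j) ≡ (keyAlong s a i <ᵇ keyAlong s a j)
  step≡ i j i→j = stepℤ≡tieKey<ᵇ (a i) (a j) (Finₚ.toℕ<n (s i)) (Finₚ.toℕ<n (s j)) (consecutive⇒toℕ≢ s-inj i→j)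

-- Standardising a sequence of pairs

StepsAlongPair : (Fin n → ℕ) → (Fin n → ℤ × ℤ) → Set
StepsAlongPair = StepsAlong (le⁺ ltPair eqPair negPair) (le⁻ ltPair eqPair negPair)

Standardises : (Fin n → Fin n) → (Fin n → Fin n) → (Fin n → ℤ) → Set
Standardises τ π c = ∀ r r′ → (toℕ (τ r) <ᵇ toℕ (τ r′)) ≡ (keyAlong π c r <ᵇ keyAlong π c r′)

module _ {π τ : Fin n → Fin n} (π-inj : Injective _≡_ _≡_ π) (τ-inj : Injective _≡_ _≡_ τ) where

  pairSteps⇔steps : {c : Fin n → ℤ} → Standardises τ π c → (b : Fin n → ℤ) →
                    StepsAlongPair (toℕ ∘ π) (λ r → b r , c r) ⇔ StepsAlongℤ (toℕ ∘ τ) b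
  pairSteps⇔steps {c} τ-std b = mk⇔ (λ (stepsAlong step) → stepsAlong λ i j i→j → trans (sym (same i j i→j)) (step i j i→j))
                                    (λ (stepsAlong step) → stepsAlong λ i j i→j → trans (same i j i→j) (step i j i→j))
    where
    same : ∀ i j → Consecutive i j →
           stepPair (toℕ (π i)) (toℕ (π j)) (b i , c i) (b j , c j) ≡ stepℤ (toℕ (τ i)) (toℕ (τ j)) (b i) (b j)
    same i j i→j = stepPair≡stepℤ (toℕ (π i)) (toℕ (π j)) (toℕ (τ i)) (toℕ (τ j)) (b i) (b j) (c i) (c j) (begin
      toℕ (τ j) <ᵇ toℕ (τ i)                          ≡⟨ <ᵇ-flip (consecutive⇒toℕ≢ τ-inj i→j) ⟩
      not (toℕ (τ i) <ᵇ toℕ (τ j))                    ≡⟨ cong not (τ-std i j) ⟩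
      not (keyAlong π c i <ᵇ keyAlong π c j)          ≡⟨ cong not (sym (stepℤ≡tieKey<ᵇ (c i) (c j) (Finₚ.toℕ<n (π i)) (Finₚ.toℕ<n (π j)) (consecutive⇒toℕ≢ π-inj i→j))) ⟩
      not (stepℤ (toℕ (π i)) (toℕ (π j)) (c i) (c j)) ∎)
      where open ≡-Reasoning

composite-standardises : {σ τ π : Fin n → Fin n} {c : Fin n → ℤ} (a : Fin n → ℤ) → (∀ r → σ (τ r) ≡ π r) →
                         (∀ r → c r ≡ a (τ r)) → OrderedBy (keyAlong σ a) → Standardises τ π c
composite-standardises {n} {σ} {τ} {π} a στ≡π c≡aτ ordered r r′ =
  trans (sym (ordered (τ r) (τ r′)))
        (cong₂ _<ᵇ_ (cong₂ (tieKey n) (sym (c≡aτ r)) (cong toℕ (στ≡π r))) (cong₂ (tieKey n) (sym (c≡aτ r′)) (cong toℕ (στ≡π r′))))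

-- The bijection

module Bijection {n : ℕ} (π : Vec (Fin n) n) (π-inj : Injective _≡_ _≡_ (lookup π)) (α β : List ℕ) where

  IsTerm : Vec (Fin n) n → List ℕ → Vec ℤ n → Bool
  IsTerm σ w a = compat (le⁺ ltP eqP negP) (le⁻ ltP eqP negP) (oneLine σ) (toList a) ∧ msEq (map ∣_∣ (toList a)) w

  Quadruple : Set
  Quadruple = Vec (Fin n) n × Vec (Fin n) n × Vec ℤ n × Vec ℤ n

  quadruples : List Quadruple
  quadruples = cartesianProduct (Sn n) (cartesianProduct (Sn n) (cartesianProduct (vecs n (cands (sum α))) (vecs n (cands (sum β)))))

  IsFactorTerm : Quadruple → Bool
  IsFactorTerm (σ , τ , a , b) = eqPerm (σ ∘ₚ τ) π ∧ (IsTerm σ α a ∧ IsTerm τ β b)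

  pairSeqs : List (Vec (ℤ × ℤ) n)
  pairSeqs = vecs n (candPairs (sum α + sum β))

  IsPairTerm : Vec (ℤ × ℤ) n → Bool
  IsPairTerm y = compat (le⁺ ltPair eqPair negPair) (le⁻ ltPair eqPair negPair) (oneLine π) (toList y)
                 ∧ msEq (map (λ ij → ∣ proj₂ ij ∣) (toList y)) α
                 ∧ msEq (map (λ ij → ∣ proj₁ ij ∣) (toList y)) β

  coeffD≡countB : (σ : Vec (Fin n) n) (w : List ℕ) → coeffD σ w ≡ countB (IsTerm σ w) (vecs n (cands (sum w)))
  coeffD≡countB σ w = countB-seqs _ n (cands (sum w))

  coeffDXY≡countB : coeffDXY π α β ≡ countB IsPairTerm pairSeqs
  coeffDXY≡countB = countB-seqs _ n (candPairs (sum α + sum β))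

  coeffRHS≡countB : coeffRHS π α β ≡ countB IsFactorTerm quadruples
  coeffRHS≡countB = begin
    coeffRHS π α β
      ≡⟨ cong sum (Listₚ.map-cong (λ σ → cong sum (Listₚ.map-cong (λ τ → term σ τ) (Sn n))) (Sn n)) ⟩
    sum (map (λ σ → sum (map (λ τ → countB (λ (a , b) → eqPerm (σ ∘ₚ τ) π ∧ (IsTerm σ α a ∧ IsTerm τ β b)) VA×VB) (Sn n))) (Sn n))
      ≡⟨ cong sum (Listₚ.map-cong (λ σ → sum-countB _ (Sn n) VA×VB) (Sn n)) ⟩
    sum (map (λ σ → countB (λ (τ , a , b) → eqPerm (σ ∘ₚ τ) π ∧ (IsTerm σ α a ∧ IsTerm τ β b)) (cartesianProduct (Sn n) VA×VB)) (Sn n))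
      ≡⟨ sum-countB _ (Sn n) _ ⟩
    countB IsFactorTerm quadruples
      ∎
    where
    open ≡-Reasoning
    VA×VB = cartesianProduct (vecs n (cands (sum α))) (vecs n (cands (sum β)))
    term : ∀ σ τ → (if eqPerm (σ ∘ₚ τ) π then coeffD σ α * coeffD τ β else 0)
                   ≡ countB (λ (a , b) → eqPerm (σ ∘ₚ τ) π ∧ (IsTerm σ α a ∧ IsTerm τ β b)) VA×VB
    term σ τ rewrite coeffD≡countB σ α | coeffD≡countB τ β
                   | countB-cartesianProduct (IsTerm σ α) (IsTerm τ β) (vecs n (cands (sum α))) (vecs n (cands (sum β))) =
      if-countB (eqPerm (σ ∘ₚ τ) π) _ VA×VB

  record IsFactorisation (σ τ : Vec (Fin n) n) (a b : Vec ℤ n) : Set where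
    field
      σ-inj     : Injective _≡_ _≡_ (lookup σ)
      τ-inj     : Injective _≡_ _≡_ (lookup τ)
      composes  : ∀ r → lookup σ (lookup τ r) ≡ lookup π r
      a-steps   : StepsAlongℤ (toℕ ∘ lookup σ) (lookup a)
      b-steps   : StepsAlongℤ (toℕ ∘ lookup τ) (lookup b)
      a-content : msEq (map ∣_∣ (toList a)) α ≡ true
      b-content : msEq (map ∣_∣ (toList b)) β ≡ true

  record IsPairSeq (y : Vec (ℤ × ℤ) n) : Set where
    field
      steps          : StepsAlongPair (toℕ ∘ lookup π) (lookup y)
      second-content : msEq (map (λ ij → ∣ proj₂ ij ∣) (toList y)) α ≡ true
      first-content  : msEq (map (λ ij → ∣ proj₁ ij ∣) (toList y)) β ≡ true

  ∈-vecs-cands⁺ : {w : List ℕ} (v : Vec ℤ n) → msEq (map ∣_∣ (toList v)) w ≡ true → v ∈ vecs n (cands (sum w))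
  ∈-vecs-cands⁺ {w} v content = ∈-vecs⁺ v (λ r → ∈-cands⁺ (sum w) (lookup v r) (msEq⇒≤sum _ w content (∈-map-toList ∣_∣ v r)))

  ∘ₚ⇔composes : (σ τ : Vec (Fin n) n) → (eqPerm (σ ∘ₚ τ) π ≡ true) ⇔ (∀ r → lookup σ (lookup τ r) ≡ lookup π r)
  ∘ₚ⇔composes σ τ = mk⇔
    (λ e r → trans (sym (Vecₚ.lookup-map r (lookup σ) τ)) (cong (λ v → lookup v r) (Equivalence.to (eqPerm⇔≡ (σ ∘ₚ τ) π) e)))
    (λ στ≡π → Equivalence.from (eqPerm⇔≡ (σ ∘ₚ τ) π)
                (trans (sym (Vecₚ.tabulate∘lookup (σ ∘ₚ τ))) (tabulate-≗ π (λ r → trans (Vecₚ.lookup-map r (lookup σ) τ) (στ≡π r)))))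

  term⇔ : (σ : Vec (Fin n) n) (w : List ℕ) (a : Vec ℤ n) →
          (IsTerm σ w a ≡ true) ⇔ (StepsAlongℤ (toℕ ∘ lookup σ) (lookup a) × msEq (map ∣_∣ (toList a)) w ≡ true)
  term⇔ σ w a = mk⇔
    (λ t → let (ok , content) = ∧-true _ t in Equivalence.to (compatible⇔steps _ _ σ a) ok , content)
    (λ (steps , content) → ∧-intro (Equivalence.from (compatible⇔steps _ _ σ a) steps) content)

  factorisation⇔ : ∀ {σ τ a b} → Counted IsFactorTerm quadruples (σ , τ , a , b) ⇔ IsFactorisation σ τ a b
  factorisation⇔ {σ} {τ} {a} {b} = mk⇔ to from
    where
    to : Counted IsFactorTerm quadruples (σ , τ , a , b) → IsFactorisation σ τ a b
    to (mem , term) = record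
      { σ-inj = ∈-Sn⁻ σ∈Sn ; τ-inj = ∈-Sn⁻ τ∈Sn
      ; composes = Equivalence.to (∘ₚ⇔composes σ τ) composes
      ; a-steps = proj₁ a-term ; b-steps = proj₁ b-term ; a-content = proj₂ a-term ; b-content = proj₂ b-term }
      where
      σ∈Sn = proj₁ (∈-cartesianProduct⁻ (Sn n) _ mem)
      τ∈Sn = proj₁ (∈-cartesianProduct⁻ (Sn n) _ (proj₂ (∈-cartesianProduct⁻ (Sn n) _ mem)))
      composes = proj₁ (∧-true (eqPerm (σ ∘ₚ τ) π) term)
      terms = ∧-true (IsTerm σ α a) (proj₂ (∧-true (eqPerm (σ ∘ₚ τ) π) term))
      a-term = Equivalence.to (term⇔ σ α a) (proj₁ terms)
      b-term = Equivalence.to (term⇔ τ β b) (proj₂ terms)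
    from : IsFactorisation σ τ a b → Counted IsFactorTerm quadruples (σ , τ , a , b)
    from F = ∈-cartesianProduct⁺ (∈-Sn⁺ σ σ-inj) (∈-cartesianProduct⁺ (∈-Sn⁺ τ τ-inj)
               (∈-cartesianProduct⁺ (∈-vecs-cands⁺ a a-content) (∈-vecs-cands⁺ b b-content)))
           , ∧-intro (Equivalence.from (∘ₚ⇔composes σ τ) composes)
                     (∧-intro (Equivalence.from (term⇔ σ α a) (a-steps , a-content)) (Equivalence.from (term⇔ τ β b) (b-steps , b-content)))
      where open IsFactorisation F

  pairSeq⇔ : ∀ {y} → Counted IsPairTerm pairSeqs y ⇔ IsPairSeq y
  pairSeq⇔ {y} = mk⇔ to from
    where
    to : Counted IsPairTerm pairSeqs y → IsPairSeq y
    to (_ , term) = record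
      { steps = Equivalence.to (compatible⇔steps _ _ π y) (proj₁ parts)
      ; second-content = proj₁ contents ; first-content = proj₂ contents }
      where
      parts = ∧-true _ term
      contents = ∧-true (msEq (map (λ ij → ∣ proj₂ ij ∣) (toList y)) α) (proj₂ parts)
    from : IsPairSeq y → Counted IsPairTerm pairSeqs y
    from Y = ∈-vecs⁺ y (λ r → ∈-candPairs⁺ (sum α + sum β) _ _
                        (≤-trans (msEq⇒≤sum _ β first-content (∈-map-toList (λ ij → ∣ proj₁ ij ∣) y r)) (m≤n+m (sum β) (sum α)))
                        (≤-trans (msEq⇒≤sum _ α second-content (∈-map-toList (λ ij → ∣ proj₂ ij ∣) y r)) (m≤m+n (sum α) (sum β))))
           , ∧-intro (Equivalence.from (compatible⇔steps _ _ π y) steps) (∧-intro second-content first-content)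
      where open IsPairSeq Y

  toPairs : Quadruple → Vec (ℤ × ℤ) n
  toPairs (σ , τ , a , b) = tabulate (λ r → lookup b r , lookup a (lookup τ r))

  module FromPairs (y : Vec (ℤ × ℤ) n) where

    c : Fin n → ℤ
    c r = proj₂ (lookup y r)

    open Standardisation (keyAlong (lookup π) c) (keyAlong-injective π-inj c) public
    open Inverse std-injective public
      renaming (f⁻¹ to std⁻¹; f∘f⁻¹ to std∘std⁻¹; f⁻¹∘f to std⁻¹∘std; f⁻¹-injective to std⁻¹-injective)

  fromPairs : Vec (ℤ × ℤ) n → Quadruple
  fromPairs y = tabulate (lookup π ∘ std⁻¹) , tabulate std , tabulate (c ∘ std⁻¹) , tabulate (proj₁ ∘ lookup y)
    where open FromPairs y

  toPairs-sound : ∀ {σ τ a b} → IsFactorisation σ τ a b → IsPairSeq (toPairs (σ , τ , a , b))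
  toPairs-sound {σ} {τ} {a} {b} F = record
    { steps = steps-tabulate (le⁺ ltPair eqPair negPair) (le⁻ ltPair eqPair negPair) (toℕ ∘ lookup π) (λ r → lookup b r , lookup a (lookup τ r))
                (Equivalence.from (pairSteps⇔steps π-inj τ-inj τ-standardises (lookup b)) b-steps)
    ; second-content = trans (msEq-reindex τ-inj (λ ij → ∣ proj₂ ij ∣) ∣_∣ y a (λ r → cong (∣_∣ ∘ proj₂) (lookup∘tabulate _ r)) α) a-content
    ; first-content  = trans (msEq-reindex (λ e → e) (λ ij → ∣ proj₁ ij ∣) ∣_∣ y b (λ r → cong (∣_∣ ∘ proj₁) (lookup∘tabulate _ r)) β) b-content }
    where
    open IsFactorisation F
    y = toPairs (σ , τ , a , b)
    τ-standardises : Standardises (lookup τ) (lookup π) (λ r → lookup a (lookup τ r))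
    τ-standardises = composite-standardises (lookup a) composes (λ _ → refl)
                       (Equivalence.to (steps⇔orderedBy-keyAlong σ-inj (lookup a)) a-steps)

  fromPairs-sound : ∀ {y} → IsPairSeq y → let (σ , τ , a , b) = fromPairs y in IsFactorisation σ τ a b
  fromPairs-sound {y} Y = record
    { σ-inj     = λ e → std⁻¹-injective (π-inj (tabulated-inj e))
    ; τ-inj     = λ e → std-injective (tabulated-inj e)
    ; composes  = λ r → trans (lookup∘tabulate _ (lookup (tabulate std) r))
                              (trans (cong (lookup π ∘ std⁻¹) (lookup∘tabulate std r)) (cong (lookup π) (std⁻¹∘std r)))
    ; a-steps   = steps-cong _ _ (λ k → cong toℕ (sym (lookup∘tabulate _ k)))
                    (λ k → sym (lookup∘tabulate _ k)) (Equivalence.from (steps⇔orderedBy-keyAlong σ-inj′ (c ∘ std⁻¹)) ordered)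
    ; b-steps   = steps-cong _ _ (λ r → cong toℕ (sym (lookup∘tabulate _ r)))
                    (λ r → sym (lookup∘tabulate _ r)) (Equivalence.to (pairSteps⇔steps π-inj std-injective std-<ᵇ (proj₁ ∘ lookup y)) steps)
    ; a-content = trans (msEq-reindex std⁻¹-injective ∣_∣ (λ ij → ∣ proj₂ ij ∣) (tabulate (c ∘ std⁻¹)) y
                           (λ k → cong ∣_∣ (lookup∘tabulate _ k)) α) second-content
    ; b-content = trans (msEq-reindex (λ e → e) ∣_∣ (λ ij → ∣ proj₁ ij ∣) (tabulate (proj₁ ∘ lookup y)) y
                           (λ r → cong ∣_∣ (lookup∘tabulate _ r)) β) first-content }
    where
    open FromPairs y
    open IsPairSeq Y
    tabulated-inj : ∀ {B : Set} {f : Fin n → B} {i j} → lookup (tabulate f) i ≡ lookup (tabulate f) j → f i ≡ f j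
    tabulated-inj {f = f} {i} {j} e = trans (sym (lookup∘tabulate f i)) (trans e (lookup∘tabulate f j))
    σ-inj′ : Injective _≡_ _≡_ (lookup π ∘ std⁻¹)
    σ-inj′ = std⁻¹-injective ∘ π-inj
    ordered : OrderedBy (keyAlong (lookup π ∘ std⁻¹) (c ∘ std⁻¹))
    ordered k k′ = trans (sym (std-<ᵇ (std⁻¹ k) (std⁻¹ k′))) (cong₂ (λ i j → toℕ i <ᵇ toℕ j) (std∘std⁻¹ k) (std∘std⁻¹ k′))

  toPairs∘fromPairs : ∀ y → toPairs (fromPairs y) ≡ y
  toPairs∘fromPairs y = tabulate-≗ y λ r → cong₂ _,_ (lookup∘tabulate _ r)
    (trans (cong (lookup (tabulate (c ∘ std⁻¹))) (lookup∘tabulate std r)) (trans (lookup∘tabulate _ (std r)) (cong c (std⁻¹∘std r))))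
    where open FromPairs y

  fromPairs∘toPairs : ∀ {σ τ a b} → IsFactorisation σ τ a b → fromPairs (toPairs (σ , τ , a , b)) ≡ (σ , τ , a , b)
  fromPairs∘toPairs {σ} {τ} {a} {b} F =
    cong₂ _,_ (tabulate-≗ σ σ≗) (cong₂ _,_ (tabulate-≗ τ std≡τ) (cong₂ _,_ (tabulate-≗ a a≗) (tabulate-≗ b b≗)))
    where
    open IsFactorisation F
    y = toPairs (σ , τ , a , b)
    open FromPairs y
    c≡aτ : ∀ r → c r ≡ lookup a (lookup τ r)
    c≡aτ r = cong proj₂ (lookup∘tabulate _ r)
    std≡τ : ∀ r → std r ≡ lookup τ r
    std≡τ = std-unique τ-inj (composite-standardises (lookup a) composes c≡aτ
              (Equivalence.to (steps⇔orderedBy-keyAlong σ-inj (lookup a)) a-steps))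
    τ∘std⁻¹ : ∀ k → lookup τ (std⁻¹ k) ≡ k
    τ∘std⁻¹ k = trans (sym (std≡τ (std⁻¹ k))) (std∘std⁻¹ k)
    σ≗ : ∀ k → lookup π (std⁻¹ k) ≡ lookup σ k
    σ≗ k = trans (sym (composes (std⁻¹ k))) (cong (lookup σ) (τ∘std⁻¹ k))
    a≗ : ∀ k → c (std⁻¹ k) ≡ lookup a k
    a≗ k = trans (c≡aτ (std⁻¹ k)) (cong (lookup a) (τ∘std⁻¹ k))
    b≗ : ∀ r → proj₁ (lookup y r) ≡ lookup b r
    b≗ r = cong proj₁ (lookup∘tabulate _ r)

  pairTerms≡factorTerms : countB IsPairTerm pairSeqs ≡ countB IsFactorTerm quadruples
  pairTerms≡factorTerms =
    countB-bijection IsPairTerm IsFactorTerm (vecs-unique n (candPairs-unique (sum α + sum β))) quadruples-unique fromPairs toPairs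
      (λ r → Equivalence.from factorisation⇔ (fromPairs-sound (Equivalence.to pairSeq⇔ r)))
      (λ {y} _ → toPairs∘fromPairs y)
      (λ r → Equivalence.from pairSeq⇔ (toPairs-sound (Equivalence.to factorisation⇔ r)))
      (λ r → fromPairs∘toPairs (Equivalence.to factorisation⇔ r))
    where
    quadruples-unique : Unique quadruples
    quadruples-unique = cartesianProduct⁺ (Sn-unique n) (cartesianProduct⁺ (Sn-unique n)
                          (cartesianProduct⁺ (vecs-unique n (cands-unique (sum α))) (vecs-unique n (cands-unique (sum β)))))

theorem6p9 : (n : ℕ) → 1 ≤ n → (π : Vec (Fin n) n) → IsPerm π →
    (α β : List ℕ) → coeffDXY π α β ≡ coeffRHS π α β
theorem6p9 n _ π π-perm α β = begin
  coeffDXY π α β                  ≡⟨ coeffDXY≡countB ⟩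
  countB IsPairTerm pairSeqs      ≡⟨ pairTerms≡factorTerms ⟩
  countB IsFactorTerm quadruples  ≡⟨ sym coeffRHS≡countB ⟩
  coeffRHS π α β                  ∎
  where
  open ≡-Reasoning
  open Bijection π (π-perm _ _) α β
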